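{- Let $n,p>0$ be integers and let $A=A^{p+1}_{n+1}$, $\le$ and $\sim$ be as in the context. For all $a,b\in A$: $a\le b$ if and only if $\sim b\le\sim a$. That is, $\sim$ is an involution.
   Context: Fix integers $n,p>0$. On $\mathbb{Z}\times\mathbb{Z}$ use componentwise addition/subtraction and the lexicographic total order $\preccurlyeq$: $(m,r)\preccurlyeq(k,s)$ iff $m<k$, or $m=k$ and $r\le s$. For an integer $j\ge 0$ let $L^\omega_{j+1}=\{(m,r)\in\mathbb{Z}^2:(0,0)\preccurlyeq(m,r)\preccurlyeq(j,0)\}$. Let $L_{p+1}=\{0,1,\dots,p\}$ with the usual order. Let $A=A^{p+1}_{n+1}=(L^\omega_{n+1}\times\{0,p\})\cup(L^\omega_{n}\times\{1,\dots,p-1\})$, with elements written $\langle(m,r),\alpha\rangle$. Define $\langle(m,r),\alpha\rangle\le\langle(k,s),\beta\rangle$ iff either (o1) $0<\alpha\le\beta$ and $(m,r)\preccurlyeq(k,s)$; or (o2) $\alpha=\beta=0$ and $(k,s)\preccurlyeq(m,r)$; or (o3) $\alpha=0<\beta$ and $(n-1,0)\preccurlyeq(m+k,r+s)$. Define $\sim\langle(m,r),\alpha\rangle=\langle(m,r),p-\alpha\rangle$ if $\alpha\in\{0,p\}$, and $\sim\langle(m,r),\alpha\rangle=\langle(n-1-m,-r),p-\alpha\rangle$ if $\alpha\notin\{0,p\}$. -}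

module Defs where

open import Data.Nat as ℕ using (ℕ)
open import Data.Integer as ℤ using (ℤ; +_; _-_; -_)
open import Data.Product using (_×_; _,_)
open import Data.Sum using (_⊎_)
open import Relation.Binary.PropositionalEquality using (_≡_)
open import Relation.Nullary using (¬_)

_≼_ : ℤ × ℤ → ℤ × ℤ → Set
(m , r) ≼ (k , s) = (m ℤ.< k) ⊎ ((m ≡ k) × (r ℤ.≤ s))

_⊕_ : ℤ × ℤ → ℤ × ℤ → ℤ × ℤ
(m , r) ⊕ (k , s) = (m ℤ.+ k , r ℤ.+ s)

-- L^ω_{j+1} = { x : (0,0) ≼ x ≼ (j,0) }
Lω : ℕ → ℤ × ℤ → Set
Lω j x = ((+ 0 , + 0) ≼ x) × (x ≼ (+ j , + 0))

Elem : Set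
Elem = (ℤ × ℤ) × ℕ

-- Membership in A = A^{p+1}_{n+1} = (L^ω_{n+1} × {0,p}) ∪ (L^ω_n × {1,…,p-1})
-- (L^ω_n = L^ω_{(n-1)+1}, here n > 0)
InA : (n p : ℕ) → Elem → Set
InA n p (x , α) =
  (Lω n x × ((α ≡ 0) ⊎ (α ≡ p)))
  ⊎ (Lω (n ℕ.∸ 1) x × (0 ℕ.< α) × (α ℕ.< p))

Leq : (n p : ℕ) → Elem → Elem → Set
Leq n p (x , α) (y , β) =
  ((0 ℕ.< α) × (α ℕ.≤ β) × (x ≼ y))
  ⊎ (((α ≡ 0) × (β ≡ 0)) × (y ≼ x))
  ⊎ (((α ≡ 0) × (0 ℕ.< β)) × ((+ n - + 1 , + 0) ≼ (x ⊕ y)))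

neg : (n p : ℕ) → Elem → Elem
neg n p ((m , r) , ℕ.zero) = ((m , r) , p)
neg n p ((m , r) , ℕ.suc α) with ℕ.suc α ℕ.≟ p
... | Relation.Nullary.yes _ = ((m , r) , 0)
... | Relation.Nullary.no _ = ((+ n - + 1 - m , - r) , p ℕ.∸ ℕ.suc α)

{-# OPTIONS --safe #-}
module Submission where

-- Writing ρ(m , r) = (n - 1 - m , - r) and c = (n - 1 , 0), the lexicographic order
-- on ℤ × ℤ is translation invariant, so ρ y ≼ x ⇔ c ≼ x ⊕ y ⇔ c ≼ y ⊕ x ⇔ ρ x ≼ y;
-- in particular ρ reverses ≼.  Sorting a, b by whether their level is 0, p or
-- strictly between, each clause (o1)-(o3) for a ≤ b becomes one of these
-- equivalences for ∼ b ≤ ∼ a, or both relations are empty.  Membership in A is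
-- needed only through the level; the bounds on the first coordinate play no role.

open import Defs
open import Data.Nat using (ℕ; _<_)
open import Data.Product using (_×_)
open import Function.Bundles using (_⇔_)

open import Data.Nat as ℕ using (suc; _≤_; _∸_)
import Data.Nat.Properties as ℕ
open import Data.Integer as ℤ using (ℤ; +_; _-_; -_)
import Data.Integer.Properties as ℤ
open import Data.Integer.Tactic.RingSolver using (solve-∀)
open import Data.Product using (_,_; proj₁; proj₂)
open import Data.Product.Function.NonDependent.Propositional using (_×-⇔_)
open import Data.Sum using (inj₁; inj₂)
open import Function.Bundles using (mk⇔; Equivalence)
open import Function.Properties.Equivalence using (sym; trans)
open import Relation.Binary.PropositionalEquality as ≡ using (_≡_; refl; subst₂; cong₂)
open import Relation.Nullary using (¬_; yes; no; contradiction)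

open Equivalence using (to)

⇔-of-empty : ∀ {a b} {A : Set a} {B : Set b} → ¬ A → ¬ B → A ⇔ B
⇔-of-empty ¬A ¬B = mk⇔ (λ x → contradiction x ¬A) (λ y → contradiction y ¬B)

∸-antitone-⇔ : ∀ {α β p} → α ≤ p → α ≤ β ⇔ p ∸ β ≤ p ∸ α
∸-antitone-⇔ {p = p} α≤p = mk⇔ (ℕ.∸-monoʳ-≤ p) (ℕ.∸-cancelʳ-≤ α≤p)

⊖_ : ℤ × ℤ → ℤ × ℤ
⊖ (m , r) = (- m , - r)

⊕-comm : ∀ u v → u ⊕ v ≡ v ⊕ u
⊕-comm (m , r) (k , s) = cong₂ _,_ (ℤ.+-comm m k) (ℤ.+-comm r s)

⊕-⊖-cancel : ∀ u w → (u ⊕ w) ⊕ (⊖ w) ≡ u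
⊕-⊖-cancel (m , r) (k , s) = cong₂ _,_ (cancel m k) (cancel r s)
  where
  cancel : ∀ a b → a ℤ.+ b ℤ.+ - b ≡ a
  cancel = solve-∀

⊕-monoˡ-≼ : ∀ {u v} w → u ≼ v → (u ⊕ w) ≼ (v ⊕ w)
⊕-monoˡ-≼ (k , s) (inj₁ m<m′)         = inj₁ (ℤ.+-monoˡ-< k m<m′)
⊕-monoˡ-≼ (k , s) (inj₂ (refl , r≤r′)) = inj₂ (refl , ℤ.+-monoˡ-≤ s r≤r′)

≼-translate : ∀ {u v u′ v′} w → u ⊕ w ≡ u′ → v ⊕ w ≡ v′ → u ≼ v ⇔ u′ ≼ v′
≼-translate {u} {v} w refl refl = mk⇔ (⊕-monoˡ-≼ w) back
  where
  back : (u ⊕ w) ≼ (v ⊕ w) → u ≼ v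
  back h = subst₂ _≼_ (⊕-⊖-cancel u w) (⊕-⊖-cancel v w) (⊕-monoˡ-≼ (⊖ w) h)

≼-⊕-comm-⇔ : ∀ c x y → c ≼ (x ⊕ y) ⇔ c ≼ (y ⊕ x)
≼-⊕-comm-⇔ c x y = ≼-translate (+ 0 , + 0) (identityʳ c) (≡.trans (identityʳ (x ⊕ y)) (⊕-comm x y))
  where
  identityʳ : ∀ u → u ⊕ (+ 0 , + 0) ≡ u
  identityʳ (m , r) = cong₂ _,_ (ℤ.+-identityʳ m) (ℤ.+-identityʳ r)

reflect : ℤ → ℤ × ℤ → ℤ × ℤ
reflect N (m , r) = (N - m , - r)

module _ (N : ℤ) where

  reflect-⊕ : ∀ x → reflect N x ⊕ x ≡ (N , + 0)
  reflect-⊕ (m , r) = cong₂ _,_ (identity N m) (ℤ.+-inverseˡ r)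
    where
    identity : ∀ a b → a - b ℤ.+ b ≡ a
    identity = solve-∀

  ⊕-reflect : ∀ x → x ⊕ reflect N x ≡ (N , + 0)
  ⊕-reflect x = ≡.trans (⊕-comm x (reflect N x)) (reflect-⊕ x)

  reflect-≼⇔≼-⊕ : ∀ x y → reflect N y ≼ x ⇔ (N , + 0) ≼ (x ⊕ y)
  reflect-≼⇔≼-⊕ x y = ≼-translate y (reflect-⊕ y) refl

  ≼⇔≼-⊕-reflect : ∀ x y → x ≼ y ⇔ (N , + 0) ≼ (y ⊕ reflect N x)
  ≼⇔≼-⊕-reflect x y = ≼-translate (reflect N x) (⊕-reflect x) refl

  reflect-antitone-⇔ : ∀ x y → x ≼ y ⇔ reflect N y ≼ reflect N x
  reflect-antitone-⇔ x y =
    trans (≼⇔≼-⊕-reflect x y)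
      (trans (≼-⊕-comm-⇔ (N , + 0) y (reflect N x))
        (sym (reflect-≼⇔≼-⊕ (reflect N x) y)))

data Level (p : ℕ) : ℕ → Set where
  bottom : Level p 0
  top    : Level p p
  middle : ∀ {α} → 0 < α → α < p → Level p α

level : ∀ {n p x α} → InA n p (x , α) → Level p α
level (inj₁ (_ , inj₁ refl))   = bottom
level (inj₁ (_ , inj₂ refl))   = top
level (inj₂ (_ , 0<α , α<p))   = middle 0<α α<p

neg-top : ∀ n {p} x → 0 < p → neg n p (x , p) ≡ (x , 0)
neg-top n {suc p} x _ with suc p ℕ.≟ suc p
... | yes _ = refl
... | no ≢  = contradiction refl ≢

neg-middle : ∀ n {p} x {α} → 0 < α → α < p → neg n p (x , α) ≡ (reflect (+ n - + 1) x , p ∸ α)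
neg-middle n {p} x {suc α} _ α<p with suc α ℕ.≟ p
... | yes ≡p = contradiction ≡p (ℕ.<⇒≢ α<p)
... | no _   = refl

module _ (n p : ℕ) where

  n-1 : ℤ
  n-1 = + n - + 1

  pivot : ℤ × ℤ
  pivot = (n-1 , + 0)

  Leq-bottom : ∀ {x y} → Leq n p (x , 0) (y , 0) ⇔ y ≼ x
  Leq-bottom = mk⇔ to′ (λ h → inj₂ (inj₁ ((refl , refl) , h)))
    where
    to′ : ∀ {x y} → Leq n p (x , 0) (y , 0) → y ≼ x
    to′ (inj₂ (inj₁ (_ , h))) = h

  Leq-positive : ∀ {x y α β} → 0 < α → 0 < β → Leq n p (x , α) (y , β) ⇔ (α ≤ β × x ≼ y)
  Leq-positive {α = suc _} {β = suc _} _ _ =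
    mk⇔ to′ (λ { (α≤β , h) → inj₁ (ℕ.z<s , α≤β , h) })
    where
    to′ : ∀ {x y α β} → Leq n p (x , suc α) (y , suc β) → (suc α ≤ suc β × x ≼ y)
    to′ (inj₁ (_ , α≤β , h))       = α≤β , h
    to′ (inj₂ (inj₁ ((() , _) , _)))
    to′ (inj₂ (inj₂ ((() , _) , _)))

  Leq-below-top : ∀ {x y α} → 0 < α → α ≤ p → Leq n p (x , α) (y , p) ⇔ x ≼ y
  Leq-below-top 0<α α≤p = trans (Leq-positive 0<α (ℕ.<-≤-trans 0<α α≤p)) (mk⇔ proj₂ (α≤p ,_))

  Leq-bottom-positive : ∀ {x y β} → 0 < β → Leq n p (x , 0) (y , β) ⇔ pivot ≼ (x ⊕ y)
  Leq-bottom-positive {β = suc _} _ = mk⇔ to′ (λ h → inj₂ (inj₂ ((refl , ℕ.z<s) , h)))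
    where
    to′ : ∀ {x y β} → Leq n p (x , 0) (y , suc β) → pivot ≼ (x ⊕ y)
    to′ (inj₂ (inj₂ (_ , h))) = h

  Leq-positive-bottom : ∀ {x y α} → 0 < α → ¬ Leq n p (x , α) (y , 0)
  Leq-positive-bottom {α = suc _} _ (inj₁ (_ , () , _))
  Leq-positive-bottom {α = suc _} _ (inj₂ (inj₁ ((() , _) , _)))
  Leq-positive-bottom {α = suc _} _ (inj₂ (inj₂ ((() , _) , _)))

  neg-antitone-⇔ : ∀ {x y α β} → 0 < p → Level p α → Level p β →
    Leq n p (x , α) (y , β) ⇔ Leq n p (neg n p (y , β)) (neg n p (x , α))
  neg-antitone-⇔ 0<p bottom bottom = trans Leq-bottom (sym (Leq-below-top 0<p ℕ.≤-refl))
  neg-antitone-⇔ {x} {y} 0<p bottom top rewrite neg-top n y 0<p =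
    trans (Leq-bottom-positive 0<p) (trans (≼-⊕-comm-⇔ pivot x y) (sym (Leq-bottom-positive 0<p)))
  neg-antitone-⇔ {x} {y} {β = β} 0<p bottom (middle 0<β β<p) rewrite neg-middle n y 0<β β<p =
    trans (Leq-bottom-positive 0<β)
      (sym (trans (Leq-below-top (ℕ.m<n⇒0<n∸m β<p) (ℕ.m∸n≤m p β)) (reflect-≼⇔≼-⊕ n-1 x y)))
  neg-antitone-⇔ {x} 0<p top bottom rewrite neg-top n x 0<p =
    ⇔-of-empty (Leq-positive-bottom 0<p) (Leq-positive-bottom 0<p)
  neg-antitone-⇔ {x} {y} 0<p top top rewrite neg-top n x 0<p | neg-top n y 0<p =
    trans (Leq-below-top 0<p ℕ.≤-refl) (sym Leq-bottom)
  neg-antitone-⇔ {x} {y} 0<p top (middle 0<β β<p) rewrite neg-top n x 0<p | neg-middle n y 0<β β<p =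
    ⇔-of-empty (λ h → ℕ.<⇒≱ β<p (proj₁ (to (Leq-positive 0<p 0<β) h)))
               (Leq-positive-bottom (ℕ.m<n⇒0<n∸m β<p))
  neg-antitone-⇔ {x} {y} 0<p (middle 0<α α<p) bottom rewrite neg-middle n x 0<α α<p =
    ⇔-of-empty (Leq-positive-bottom 0<α)
               (λ h → ℕ.<⇒≱ (ℕ.∸-monoʳ-< 0<α (ℕ.<⇒≤ α<p))
                            (proj₁ (to (Leq-positive 0<p (ℕ.m<n⇒0<n∸m α<p)) h)))
  neg-antitone-⇔ {x} {y} 0<p (middle 0<α α<p) top rewrite neg-middle n x 0<α α<p | neg-top n y 0<p =
    trans (Leq-below-top 0<α (ℕ.<⇒≤ α<p))
      (trans (≼⇔≼-⊕-reflect n-1 x y) (sym (Leq-bottom-positive (ℕ.m<n⇒0<n∸m α<p))))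
  neg-antitone-⇔ {x} {y} 0<p (middle 0<α α<p) (middle 0<β β<p)
    rewrite neg-middle n x 0<α α<p | neg-middle n y 0<β β<p =
    trans (Leq-positive 0<α 0<β)
      (trans (∸-antitone-⇔ (ℕ.<⇒≤ α<p) ×-⇔ reflect-antitone-⇔ n-1 x y)
        (sym (Leq-positive (ℕ.m<n⇒0<n∸m β<p) (ℕ.m<n⇒0<n∸m α<p))))

lemma2p3 : (n p : ℕ) → 0 < n → 0 < p →
    (a b : Elem) → InA n p a → InA n p b →
    (Leq n p a b ⇔ Leq n p (neg n p b) (neg n p a))
lemma2p3 n p _ 0<p _ _ a∈A b∈A = neg-antitone-⇔ n p 0<p (level a∈A) (level b∈A)
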